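{- Let $F$ be a totally real number field with real places $\Sigma_\infty$, let integers $\kappa_v,\kappa'_v>1$ ($v\in\Sigma_\infty$) be given, $\Sigma_{ub}=\{v:\kappa_v>\kappa'_v\}$, $\Sigma_b=\{v:\kappa_v\le\kappa'_v\}$, $r_v=\kappa_v-\kappa'_v-1$ for $v\in\Sigma_{ub}$ and $r_v=\kappa'_v-\kappa_v$ for $v\in\Sigma_b$. Put $t^0=\min_{v\in\Sigma_{ub}}r_v$, $a^0=\min\{r_v: v\in\Sigma_b,\ 2\kappa_v>\kappa'_v\}$, $b^0=\min\{\kappa_v-1: v\in\Sigma_b,\ \kappa'_v\ge2\kappa_v\}$ (a minimum over an empty set being $+\infty$). Call a half-integer $m+\frac12$ ($m\in\mathbb Z$) critical if neither $L_\infty(s)$ nor $L_\infty(1-s)$ has a pole at $s=m+\frac12$, where \[ L_\infty(s)=\prod_{v\in\Sigma_\infty}\Gamma_{\mathbb C}(s+\kappa_v-\tfrac12)\Gamma_{\mathbb C}(s+\kappa_v+\kappa'_v-\tfrac12)\prod_{v\in\Sigma_{ub}}\Gamma_{\mathbb C}(s+\kappa_v-\kappa'_v-\tfrac12)\prod_{v\in\Sigma_b}\Gamma_{\mathbb C}(s+\kappa'_v-\kappa_v+\tfrac12), \] $\Gamma_{\mathbb C}(s)=2(2\pi)^{ -s}\Gamma(s)$. Then the set of critical points is $\{m+\frac12: m\in\mathbb Z,\ -\min\{a^0,b^0,t^0\}\le m\le\min\{a^0,b^0,t^0\}\}$. In particular $s=\frac12$ is critical.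
   Context: $L_\infty(s)$ is the archimedean factor of the completed $L$-function $L(s,\operatorname{Sym}^2\tau\times\pi)$ for cuspidal $\tau,\pi$ on $\mathrm{PGL}_2(\mathbb A_F)$ of weights $\kappa'+1$ and $2\kappa$. -}

module Defs where

open import Data.Nat as ℕ using (ℕ; zero; suc; _<ᵇ_; _≤ᵇ_) renaming (_*_ to _*ℕ_)
open import Data.Integer using (ℤ; +_; -_; _+_; _-_; _*_; _≤_)
open import Data.Fin using (Fin; zero; suc)
open import Data.List using (List; []; _∷_; _++_; concatMap)
open import Data.List.Relation.Unary.Any using (Any)
open import Data.Product using (∃; _×_)
open import Data.Bool using (Bool; true; false; if_then_else_)
open import Data.Unit using (⊤)
open import Relation.Binary.PropositionalEquality using (_≡_)
open import Relation.Nullary using (¬_)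

data ℕ∞ : Set where
  fin : ℕ → ℕ∞
  ∞   : ℕ∞

min∞ : ℕ∞ → ℕ∞ → ℕ∞
min∞ (fin a) (fin b) = fin (ℕ._⊓_ a b)
min∞ (fin a) ∞ = fin a
min∞ ∞ y = y

_≤∞_ : ℤ → ℕ∞ → Set
z ≤∞ fin k = z ≤ + k
z ≤∞ ∞ = ⊤

minOver : (n : ℕ) → (Fin n → Bool) → (Fin n → ℕ) → ℕ∞
minOver zero P f = ∞
minOver (suc n) P f =
  min∞ (if P zero then fin (f zero) else ∞) (minOver n (λ v → P (suc v)) (λ v → f (suc v)))

module Setup (n : ℕ) (κ κ' : Fin n → ℕ) where

  isUB : Fin n → Bool
  isUB v = κ' v <ᵇ κ v

  r : Fin n → ℕ
  r v = if isUB v then ℕ._∸_ (ℕ._∸_ (κ v) (κ' v)) 1 else ℕ._∸_ (κ' v) (κ v)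

  t⁰ a⁰ b⁰ : ℕ∞
  t⁰ = minOver n isUB r
  a⁰ = minOver n (λ v → if isUB v then false else κ' v <ᵇ 2 *ℕ κ v) r
  b⁰ = minOver n (λ v → if isUB v then false else 2 *ℕ κ v ≤ᵇ κ' v) (λ v → ℕ._∸_ (κ v) 1)

  M⁰ : ℕ∞
  M⁰ = min∞ a⁰ (min∞ b⁰ t⁰)

  -- Points of (1/2)ℤ are represented by their doubles: the integer d stands for d/2.
  -- Γ_ℂ(z) = 2(2π)^{-z} Γ(z) has poles exactly at z ∈ {0, -1, -2, ...}.
  ΓℂPole : ℤ → Set
  ΓℂPole d = ∃ λ (k : ℕ) → d ≡ - (+ (2 *ℕ k))

  -- L_∞(s) = ∏ Γ_ℂ(s + c/2), c ranging over this list of doubled shifts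
  shifts : Fin n → List ℤ
  shifts v = (+ (2 *ℕ κ v) - + 1)
           ∷ (+ (2 *ℕ κ v) + + (2 *ℕ κ' v) - + 1)
           ∷ (if isUB v then + (2 *ℕ κ v) - + (2 *ℕ κ' v) - + 1
                        else + (2 *ℕ κ' v) - + (2 *ℕ κ v) + + 1)
           ∷ []

  allFinL : (m : ℕ) → List (Fin m)
  allFinL zero = []
  allFinL (suc m) = zero ∷ Data.List.map suc (allFinL m)

  LShifts : List ℤ
  LShifts = concatMap shifts (allFinL n)

  -- L_∞ has a pole at the point with doubled coordinate d
  -- (a finite product of Γ-factors, which have no zeros, has a pole iff some factor does)
  LPole : ℤ → Set
  LPole d = Any (λ c → ΓℂPole (d + c)) LShifts

  Critical : ℤ → Set
  Critical m = ¬ LPole (+ 2 * m + + 1) × ¬ LPole (+ 2 - (+ 2 * m + + 1))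

-- Γ_ℂ has no zeros and its poles are the non-positive integers, so L_∞ has a pole at
-- s = 1/2 - z (z ∈ ℤ) iff z ≥ h for one of the integers h with Γ_ℂ(s - 1/2 + h) a factor
-- of L_∞. At a place these are κ, κ + κ' and κ - κ' (if κ > κ') or κ' - κ + 1 (if κ ≤ κ'),
-- and the least of them minus one is exactly the contribution of the place to
-- min{a⁰, b⁰, t⁰}: κ - 1 when κ' ≥ 2κ and r_v otherwise. So L_∞ has no pole at 1/2 - z iff
-- z ≤ min{a⁰, b⁰, t⁰}; for s = m + 1/2 this is applied to z = -m (for L_∞(s)) and to
-- z = m (for L_∞(1 - s)).
module Submission where

open import Defs
open import Data.Nat using (ℕ; NonZero; _<_)
open import Data.Integer using (ℤ; -_; +_)
open import Data.Fin using (Fin)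
open import Data.Product using (_×_)
open import Function.Bundles using (_⇔_)

open import Level using (0ℓ)
open import Function using (_∘_)
open import Function.Bundles using (mk⇔; Equivalence)
import Function.Properties.Equivalence as ⇔
open import Data.Bool using (true; false; if_then_else_; T)
open import Data.Unit using (tt)
open import Data.Product using (_,_; proj₁; proj₂)
open import Data.Product.Function.NonDependent.Propositional using (_×-⇔_)
open import Data.Fin using (zero; suc)
open import Data.Fin.Properties using (∀-cons-⇔)
import Data.Nat as ℕ
import Data.Nat.Properties as ℕ
open import Data.Integer using (_+_; _-_; _*_; _≤_; +≤+; -≤+; -[1+_])
import Data.Integer as ℤ
open import Data.Integer.Properties
  using (pos-*; m-n≡m⊖n; i⊓j≤i; i⊓j≤j; ⊓-glb; ⊖-≥; ≤-refl; ≤-trans; <-≤-trans; <⇒≱; ≰⇒>; i≤i+j; i-j≤i;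
         i≤j⇒i-j≤0; i-j≤0⇒i≤j; i<j⇒i≤pred[j]; i≤pred[j]⇒i<j)
open import Data.Integer.Tactic.RingSolver using (solve-∀)
open import Data.List using (List; []; _∷_; map)
open import Data.List.Membership.Propositional using (_∈_)
open import Data.List.Relation.Unary.Any using (here; there)
open import Data.List.Relation.Unary.All as All using (All; []; _∷_)
open import Data.List.Relation.Unary.All.Properties using (¬Any⇒All¬; All¬⇒¬Any; concat⁺; concat⁻; map⁺; map⁻)
open import Relation.Nullary using (¬_; contradiction)
open import Relation.Nullary.Reflects using (ofʸ; ofⁿ)
open import Relation.Binary.PropositionalEquality using (_≡_; refl; sym; trans; cong; cong₂; subst)
import Relation.Binary.Reasoning.Setoid as SetoidReasoning

open Equivalence using (to; from)

∀-⇔ : ∀ {A : Set} {P Q : A → Set} → (∀ x → P x ⇔ Q x) → (∀ x → P x) ⇔ (∀ x → Q x)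
∀-⇔ P⇔Q = mk⇔ (λ p x → to (P⇔Q x) (p x)) (λ q x → from (P⇔Q x) (q x))

All-⇔ : ∀ {A : Set} {P Q : A → Set} {xs} → (∀ x → P x ⇔ Q x) → All P xs ⇔ All Q xs
All-⇔ P⇔Q = mk⇔ (All.map (to (P⇔Q _))) (All.map (from (P⇔Q _)))

∀-×-⇔ : ∀ {A : Set} {P Q : A → Set} → ((∀ x → P x) × (∀ x → Q x)) ⇔ (∀ x → P x × Q x)
∀-×-⇔ = mk⇔ (λ (p , q) x → p x , q x) (λ pq → proj₁ ∘ pq , proj₂ ∘ pq)

All<⇔<min : ∀ {z h : ℤ} {hs} → h ∈ hs → All (h ≤_) hs → All (z ℤ.<_) hs ⇔ z ℤ.< h
All<⇔<min h∈hs h≤hs = mk⇔ (λ z<hs → All.lookup z<hs h∈hs) (λ z<h → All.map (<-≤-trans z<h) h≤hs)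

0≤∞ : ∀ x → (+ 0) ≤∞ x
0≤∞ (fin _) = +≤+ ℕ.z≤n
0≤∞ ∞ = tt

≤∞-min∞ : ∀ {z} x y → z ≤∞ min∞ x y ⇔ (z ≤∞ x × z ≤∞ y)
≤∞-min∞ (fin a) (fin b) = mk⇔
  (λ z≤a⊓b → ≤-trans z≤a⊓b (i⊓j≤i (+ a) (+ b)) , ≤-trans z≤a⊓b (i⊓j≤j (+ a) (+ b)))
  (λ (z≤a , z≤b) → ⊓-glb z≤a z≤b)
≤∞-min∞ (fin a) ∞ = mk⇔ (_, tt) (λ (z≤a , _) → z≤a)
≤∞-min∞ ∞ y = mk⇔ (tt ,_) (λ (_ , z≤y) → z≤y)

≤∞-fin-if : ∀ {z} b k → z ≤∞ (if b then fin k else ∞) ⇔ (T b → z ≤ + k)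
≤∞-fin-if true k = mk⇔ (λ z≤k _ → z≤k) (λ z≤k → z≤k tt)
≤∞-fin-if false k = mk⇔ (λ _ ()) (λ _ → tt)

≤∞-minOver : ∀ {z} n P f → z ≤∞ minOver n P f ⇔ (∀ v → T (P v) → z ≤ + f v)
≤∞-minOver ℕ.zero P f = mk⇔ (λ _ ()) (λ _ → tt)
≤∞-minOver (ℕ.suc n) P f =
  ⇔.trans (≤∞-min∞ _ _)
    (⇔.trans (≤∞-fin-if (P zero) (f zero) ×-⇔ ≤∞-minOver n (P ∘ suc) (f ∘ suc)) ∀-cons-⇔)

pos-∸ : ∀ {m n} → n ℕ.≤ m → + (m ℕ.∸ n) ≡ + m - + n
pos-∸ {m} {n} n≤m = sym (trans (m-n≡m⊖n m n) (⊖-≥ n≤m))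

<⇔≤∸1 : ∀ {z a} → 1 ℕ.≤ a → z ℤ.< + a ⇔ z ≤ + (a ℕ.∸ 1)
<⇔≤∸1 {a = ℕ.suc _} _ = mk⇔ i<j⇒i≤pred[j] i≤pred[j]⇒i<j

1+m-n≡pos-suc-∸ : ∀ {m n} → n ℕ.≤ m → + 1 + (+ m - + n) ≡ + ℕ.suc (m ℕ.∸ n)
1+m-n≡pos-suc-∸ n≤m = cong (λ d → + 1 + d) (sym (pos-∸ n≤m))

double≡+ : ∀ n → 2 ℕ.* n ≡ n ℕ.+ n
double≡+ n = cong (n ℕ.+_) (ℕ.+-identityʳ n)

-- The integer parts h of the Γ_ℂ-arguments s - 1/2 + h of L_∞ at a place of weights k, k'.
offsets : ℕ → ℕ → List ℤ
offsets k k' = + k ∷ + k + + k' ∷ (if k' ℕ.<ᵇ k then + k - + k' else + 1 + (+ k' - + k)) ∷ []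

doubledShifts≡ : ∀ b (x y : ℤ) →
    (+ 2 * x - + 1) ∷ (+ 2 * x + + 2 * y - + 1)
      ∷ (if b then + 2 * x - + 2 * y - + 1 else + 2 * y - + 2 * x + + 1) ∷ []
  ≡ map (λ h → + 2 * h - + 1) (x ∷ x + y ∷ (if b then x - y else + 1 + (y - x)) ∷ [])
doubledShifts≡ b x y = cong₂ _∷_ refl (cong₂ _∷_ (sum≡ x y) (cong (_∷ []) (last≡ b)))
  where
  sum≡ : ∀ x y → + 2 * x + + 2 * y - + 1 ≡ + 2 * (x + y) - + 1
  sum≡ = solve-∀
  difference≡ : ∀ x y → + 2 * x - + 2 * y - + 1 ≡ + 2 * (x - y) - + 1
  difference≡ = solve-∀
  1+difference≡ : ∀ x y → + 2 * y - + 2 * x + + 1 ≡ + 2 * (+ 1 + (y - x)) - + 1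
  1+difference≡ = solve-∀
  last≡ : ∀ b → (if b then + 2 * x - + 2 * y - + 1 else + 2 * y - + 2 * x + + 1)
              ≡ + 2 * (if b then x - y else + 1 + (y - x)) - + 1
  last≡ true = difference≡ x y
  last≡ false = 1+difference≡ x y

-- The conditions that a⁰, b⁰ and t⁰ respectively impose on z at a place of weights k, k'.
PlaceConstraints : ℤ → ℕ → ℕ → Set
PlaceConstraints z k k' =
    (T (if k' ℕ.<ᵇ k then false else k' ℕ.<ᵇ 2 ℕ.* k) → z ≤ + r)
  × (T (if k' ℕ.<ᵇ k then false else 2 ℕ.* k ℕ.≤ᵇ k') → z ≤ + (k ℕ.∸ 1))
  × (T (k' ℕ.<ᵇ k) → z ≤ + r)
  where r = if k' ℕ.<ᵇ k then k ℕ.∸ k' ℕ.∸ 1 else k' ℕ.∸ k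

All<offsets⇔PlaceConstraints : ∀ z {k} k' → 1 ℕ.≤ k →
  All (z ℤ.<_) (offsets k k') ⇔ PlaceConstraints z k k'
All<offsets⇔PlaceConstraints z {k} k' 1≤k with k' ℕ.<ᵇ k | ℕ.<ᵇ-reflects-< k' k
... | true | ofʸ k'<k =
  ⇔.trans (All<⇔<min (there (there (here refl)))
                     (k-k'≤k ∷ ≤-trans k-k'≤k (i≤i+j (+ k) (+ k')) ∷ ≤-refl ∷ []))
          (mk⇔ (λ z<k-k' → (λ ()) , (λ ()) , λ _ → to z<k-k'⇔ z<k-k')
               (λ (_ , _ , z≤r) → from z<k-k'⇔ (z≤r tt)))
  where
  k-k'≤k : + k - + k' ≤ + k
  k-k'≤k = i-j≤i (+ k) (+ k')
  z<k-k'⇔ : z ℤ.< + k - + k' ⇔ z ≤ + (k ℕ.∸ k' ℕ.∸ 1)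
  z<k-k'⇔ = subst (λ d → z ℤ.< d ⇔ z ≤ + (k ℕ.∸ k' ℕ.∸ 1))
                  (pos-∸ (ℕ.<⇒≤ k'<k)) (<⇔≤∸1 (ℕ.m<n⇒0<n∸m k'<k))
... | false | ofⁿ k'≮k with k' ℕ.<ᵇ 2 ℕ.* k | ℕ.<ᵇ-reflects-< k' (2 ℕ.* k)
...   | true | ofʸ k'<2k =
  ⇔.trans (All<⇔<min (there (there (here refl)))
                     (1+k'-k≤k ∷ ≤-trans 1+k'-k≤k (i≤i+j (+ k) (+ k')) ∷ ≤-refl ∷ []))
          (mk⇔ (λ z<1+k'-k → (λ _ → to z<1+k'-k⇔ z<1+k'-k) , 2k≰k' , λ ())
               (λ (z≤r , _ , _) → from z<1+k'-k⇔ (z≤r tt)))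
  where
  k≤k' : k ℕ.≤ k'
  k≤k' = ℕ.≮⇒≥ k'≮k
  2k≰k' : ∀ {A : Set} → T (2 ℕ.* k ℕ.≤ᵇ k') → A
  2k≰k' 2k≤k' = contradiction (ℕ.≤ᵇ⇒≤ _ _ 2k≤k') (ℕ.<⇒≱ k'<2k)
  1+k'-k≤k : + 1 + (+ k' - + k) ≤ + k
  1+k'-k≤k = subst (_≤ + k) (sym (1+m-n≡pos-suc-∸ k≤k'))
                   (+≤+ (ℕ.m<n+o⇒m∸n<o k' k {{ℕ.>-nonZero 1≤k}} (subst (k' ℕ.<_) (double≡+ k) k'<2k)))
  z<1+k'-k⇔ : z ℤ.< + 1 + (+ k' - + k) ⇔ z ≤ + (k' ℕ.∸ k)
  z<1+k'-k⇔ = subst (λ d → z ℤ.< d ⇔ z ≤ + (k' ℕ.∸ k))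
                    (sym (1+m-n≡pos-suc-∸ k≤k')) (<⇔≤∸1 (ℕ.s≤s ℕ.z≤n))
...   | false | ofⁿ k'≮2k =
  ⇔.trans (All<⇔<min (here refl) (≤-refl ∷ i≤i+j (+ k) (+ k') ∷ k≤1+k'-k ∷ []))
          (mk⇔ (λ z<k → (λ ()) , (λ _ → to (<⇔≤∸1 1≤k) z<k) , λ ())
               (λ (_ , z≤k-1 , _) → from (<⇔≤∸1 1≤k) (z≤k-1 (ℕ.≤⇒≤ᵇ 2k≤k'))))
  where
  2k≤k' : 2 ℕ.* k ℕ.≤ k'
  2k≤k' = ℕ.≮⇒≥ k'≮2k
  k+k≤k' : k ℕ.+ k ℕ.≤ k'
  k+k≤k' = subst (ℕ._≤ k') (double≡+ k) 2k≤k'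
  k≤1+k'-k : + k ≤ + 1 + (+ k' - + k)
  k≤1+k'-k = subst (+ k ≤_) (sym (1+m-n≡pos-suc-∸ (ℕ.m+n≤o⇒n≤o k k+k≤k')))
                   (+≤+ (ℕ.m≤n⇒m≤1+n (ℕ.m+n≤o⇒m≤o∸n k k+k≤k')))

module CriticalStrip (n : ℕ) (κ κ' : Fin n → ℕ) (1≤κ : ∀ v → 1 ℕ.≤ κ v) where
  open Setup n κ κ'

  ΓℂPole-double⇔≤0 : ∀ y → ΓℂPole (+ 2 * y) ⇔ y ≤ + 0
  ΓℂPole-double⇔≤0 y = mk⇔ (pole⇒≤0 y) (≤0⇒pole y)
    where
    pole⇒≤0 : ∀ y → ΓℂPole (+ 2 * y) → y ≤ + 0
    pole⇒≤0 (+ ℕ.zero) _ = +≤+ ℕ.z≤n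
    pole⇒≤0 (+ ℕ.suc _) (ℕ.zero , ())
    pole⇒≤0 (+ ℕ.suc _) (ℕ.suc _ , ())
    pole⇒≤0 -[1+ _ ] _ = -≤+
    ≤0⇒pole : ∀ y → y ≤ + 0 → ΓℂPole (+ 2 * y)
    ≤0⇒pole (+ ℕ.zero) _ = 0 , refl
    ≤0⇒pole (+ ℕ.suc _) (+≤+ ())
    ≤0⇒pole -[1+ k ] _ = ℕ.suc k , refl

  noΓℂPole⇔< : ∀ z h → (¬ ΓℂPole (+ 1 - + 2 * z + (+ 2 * h - + 1))) ⇔ z ℤ.< h
  noΓℂPole⇔< z h = subst (λ d → (¬ ΓℂPole d) ⇔ z ℤ.< h) (sym (argument≡ z h)) (mk⇔
    (λ ¬pole → ≰⇒> (¬pole ∘ from (ΓℂPole-double⇔≤0 (h - z)) ∘ i≤j⇒i-j≤0))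
    (λ z<h → <⇒≱ z<h ∘ i-j≤0⇒i≤j ∘ to (ΓℂPole-double⇔≤0 (h - z))))
    where
    argument≡ : ∀ z h → + 1 - + 2 * z + (+ 2 * h - + 1) ≡ + 2 * (h - z)
    argument≡ = solve-∀

  shifts≡ : ∀ v → shifts v ≡ map (λ h → + 2 * h - + 1) (offsets (κ v) (κ' v))
  shifts≡ v = trans (cong₂ shiftList (pos-* 2 (κ v)) (pos-* 2 (κ' v)))
                    (doubledShifts≡ (isUB v) (+ κ v) (+ κ' v))
    where
    shiftList : ℤ → ℤ → List ℤ
    shiftList a a' = (a - + 1) ∷ (a + a' - + 1) ∷ (if isUB v then a - a' - + 1 else a' - a + + 1) ∷ []

  All-allFinL⇔ : ∀ m {Q : Fin m → Set} → All Q (allFinL m) ⇔ (∀ v → Q v)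
  All-allFinL⇔ m = mk⇔ (all⇒∀ m) (∀⇒all m)
    where
    all⇒∀ : ∀ m {Q : Fin m → Set} → All Q (allFinL m) → ∀ v → Q v
    all⇒∀ (ℕ.suc m) (q ∷ _) zero = q
    all⇒∀ (ℕ.suc m) (_ ∷ qs) (suc v) = all⇒∀ m (map⁻ qs) v
    ∀⇒all : ∀ m {Q : Fin m → Set} → (∀ v → Q v) → All Q (allFinL m)
    ∀⇒all ℕ.zero _ = []
    ∀⇒all (ℕ.suc m) q = q zero ∷ map⁺ (∀⇒all m (q ∘ suc))

  ¬LPole⇔ : ∀ d → (¬ LPole d) ⇔ (∀ v → All (λ c → ¬ ΓℂPole (d + c)) (shifts v))
  ¬LPole⇔ d = mk⇔
    (λ ¬pole → to (All-allFinL⇔ n) (map⁻ (concat⁻ (¬Any⇒All¬ _ ¬pole))))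
    (λ ¬poles → All¬⇒¬Any (concat⁺ (map⁺ (from (All-allFinL⇔ n) ¬poles))))

  noPoleAtPlace⇔ : ∀ z v →
    All (λ c → ¬ ΓℂPole (+ 1 - + 2 * z + c)) (shifts v) ⇔ All (z ℤ.<_) (offsets (κ v) (κ' v))
  noPoleAtPlace⇔ z v rewrite shifts≡ v = ⇔.trans (mk⇔ map⁻ map⁺) (All-⇔ (noΓℂPole⇔< z))

  ≤M⁰⇔ : ∀ z → z ≤∞ M⁰ ⇔ (∀ v → PlaceConstraints z (κ v) (κ' v))
  ≤M⁰⇔ z =
    ⇔.trans (≤∞-min∞ a⁰ _)
    (⇔.trans (≤∞-minOver n _ _ ×-⇔ ⇔.trans (≤∞-min∞ b⁰ t⁰) (≤∞-minOver n _ _ ×-⇔ ≤∞-minOver n _ _))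
    (⇔.trans (⇔.refl ×-⇔ ∀-×-⇔) ∀-×-⇔))

  noLPole⇔≤M⁰ : ∀ z → (¬ LPole (+ 1 - + 2 * z)) ⇔ z ≤∞ M⁰
  noLPole⇔≤M⁰ z = begin
    ¬ LPole (+ 1 - + 2 * z)                                       ≈⟨ ¬LPole⇔ (+ 1 - + 2 * z) ⟩
    (∀ v → All (λ c → ¬ ΓℂPole (+ 1 - + 2 * z + c)) (shifts v))   ≈⟨ ∀-⇔ (noPoleAtPlace⇔ z) ⟩
    (∀ v → All (z ℤ.<_) (offsets (κ v) (κ' v)))
      ≈⟨ ∀-⇔ (λ v → All<offsets⇔PlaceConstraints z (κ' v) (1≤κ v)) ⟩
    (∀ v → PlaceConstraints z (κ v) (κ' v))                       ≈⟨ ⇔.sym (≤M⁰⇔ z) ⟩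
    z ≤∞ M⁰                                                       ∎
    where open SetoidReasoning (⇔.⇔-setoid 0ℓ)

  critical⇔ : ∀ m → Critical m ⇔ ((- m) ≤∞ M⁰ × m ≤∞ M⁰)
  critical⇔ m =
        subst (λ d → (¬ LPole d) ⇔ (- m) ≤∞ M⁰) (sym (s≡ m)) (noLPole⇔≤M⁰ (- m))
    ×-⇔ subst (λ d → (¬ LPole d) ⇔ m ≤∞ M⁰) (sym (1-s≡ m)) (noLPole⇔≤M⁰ m)
    where
    s≡ : ∀ m → + 2 * m + + 1 ≡ + 1 - + 2 * (- m)
    s≡ = solve-∀
    1-s≡ : ∀ m → + 2 - (+ 2 * m + + 1) ≡ + 1 - + 2 * m
    1-s≡ = solve-∀

proposition5p1 : (n : ℕ) → .{{_ : NonZero n}} → (κ κ' : Fin n → ℕ)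
    → (∀ v → 1 < κ v) → (∀ v → 1 < κ' v)
    → ((m : ℤ) → Setup.Critical n κ κ' m ⇔ ((- m) ≤∞ Setup.M⁰ n κ κ' × m ≤∞ Setup.M⁰ n κ κ'))
      × Setup.Critical n κ κ' (+ 0)
proposition5p1 n κ κ' 1<κ _ = critical⇔ , from (critical⇔ (+ 0)) (0≤∞ M⁰ , 0≤∞ M⁰)
  where
  open Setup n κ κ'
  open CriticalStrip n κ κ' (λ v → ℕ.<⇒≤ (1<κ v))
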